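{- The equivalent algebraic semantics of $L_{\rm LEA}$ (with respect to equivalence formulas $\{p\rightarrow q,q\rightarrow p\}$ and defining identity $p\approx p\rightarrow p$) is the quasivariety of algebras $(I,\rightarrow,0)$ of type $(2,0)$ axiomatized by the following identities and quasiidentities, where $x':=x\rightarrow0$ and $1:=0'$: (1) $x\rightarrow(y\rightarrow x)\approx1$; (2) $((x\rightarrow y)\rightarrow y)\rightarrow((y\rightarrow x)\rightarrow x)\approx1$; (3) $0\rightarrow x\approx1$; (4) $x\rightarrow x\approx1$; (5) if $x=1$ and $x\rightarrow y=1$ then $y=1$; (6) if $x\rightarrow y=1$ then $(y\rightarrow z)\rightarrow(x\rightarrow z)=1$; (7) if $x\rightarrow y=1$ then $(x'\rightarrow y')\rightarrow(y\rightarrow x)=1$; (8) if $x\rightarrow y=1$ and $y\rightarrow x=1$ then $x=y$; (9) if $x\rightarrow y'=1$ and $(x'\rightarrow y)\rightarrow z'=1$ then $((x'\rightarrow y)'\rightarrow z)\rightarrow(x'\rightarrow(y'\rightarrow z))=1$. Moreover, this quasivariety is exactly the class of lattice effect implication algebras.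
   Context: Formulas are built from propositional variables using a binary connective $\rightarrow$ and a constant $0$; $\neg\varphi:=\varphi\rightarrow0$. The logic $L_{\rm LEA}$ is the consequence relation $\vdash$ of the deductive system with axiom schemes (A1) $\varphi\rightarrow(\psi\rightarrow\varphi)$; (A2) $((\varphi\rightarrow\psi)\rightarrow\psi)\rightarrow((\psi\rightarrow\varphi)\rightarrow\varphi)$; (A3) $0\rightarrow\varphi$; and inference rules (MP) $\varphi,\varphi\rightarrow\psi\vdash\psi$; (Sf) $\varphi\rightarrow\psi\vdash(\psi\rightarrow\chi)\rightarrow(\varphi\rightarrow\chi)$; (WPf) $\varphi\rightarrow\psi,\psi\rightarrow\varphi\vdash(\chi\rightarrow\varphi)\rightarrow(\chi\rightarrow\psi)$; (R1) $\varphi\rightarrow\psi\vdash(\neg\varphi\rightarrow\neg\psi)\rightarrow(\psi\rightarrow\varphi)$; (R2) $\varphi\rightarrow\neg\psi,(\neg\varphi\rightarrow\psi)\rightarrow\neg\chi\vdash(\neg(\neg\varphi\rightarrow\psi)\rightarrow\chi)\rightarrow(\neg\varphi\rightarrow(\neg\psi\rightarrow\chi))$. A class $\mathcal K$ of algebras is an equivalent algebraic semantics of a deductive system $\vdash$ with equivalence formulas $\Delta(p,q)$ and defining identity $\delta(p)\approx\varepsilon(p)$ if (1) $\Gamma\vdash\varphi$ iff $\{\delta(\psi)\approx\varepsilon(\psi):\psi\in\Gamma\}\models_{\mathcal K}\delta(\varphi)\approx\varepsilon(\varphi)$ for all $\Gamma\cup\{\varphi\}$, and (2) $\varphi\approx\psi$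 and $\{\delta(\chi)\approx\varepsilon(\chi):\chi\in\Delta(\varphi,\psi)\}$ are mutually $\mathcal K$-consequences of each other; here $\Sigma\models_{\mathcal K}s\approx t$ means every assignment in every member of $\mathcal K$ satisfying $\Sigma$ satisfies $s\approx t$. The equivalent algebraic semantics which is a quasivariety is unique. A lattice effect implication algebra is an algebra $(I,\rightarrow,0)$ such that, with $x':=x\rightarrow0$ and $1:=0'$, for all $x,y,z\in I$: (i) $0\rightarrow x=x\rightarrow x=x\rightarrow1=1$; (ii) if $x\rightarrow y=y\rightarrow x=1$ then $x=y$; (iii) if $x\rightarrow y=y\rightarrow z=1$ then $x\rightarrow z=1$; (iv) if $x\rightarrow y=1$ then $y'\rightarrow x'=1$; (v) $x''=x$; (vi) $x\rightarrow((x\rightarrow y)\rightarrow y)=1$; (vii) $y\rightarrow((x\rightarrow y)\rightarrow y)=1$; (viii) if $x\rightarrow z=y\rightarrow z=1$ then $((x\rightarrow y)\rightarrow y)\rightarrow z=1$; (ix) if $x\rightarrow y=1$ then $y\rightarrow x=x'\rightarrow y'$; (x) [$x\rightarrow y'=1$ and $(x'\rightarrow y)\rightarrow z'=1$] if and only if [$y\rightarrow z'=1$ and $x\rightarrow(y'\rightarrow z)'=1$], and in this case $(x'\rightarrow y)'\rightarrow z=x'\rightarrow(y'\rightarrow z)$; (xi) $y'\rightarrow((x\rightarrow y)\rightarrow y)'=x\rightarrow y$; (xii) $x\rightarrow(y\rightarrow x)=1$. -}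

module Defs where

open import Level using (Level; _⊔_) renaming (suc to lsuc)
open import Data.Nat using (ℕ)
open import Data.List using (List; _∷_; [])
open import Data.List.Membership.Propositional using (_∈_)
open import Data.Product using (_×_)
open import Relation.Binary using (IsEquivalence)

infixr 6 _⇒_
data Formula : Set where
  var : ℕ → Formula
  _⇒_ : Formula → Formula → Formula
  𝟘   : Formula

∼_ : Formula → Formula
∼ φ = φ ⇒ 𝟘
infix 7 ∼_

infix 3 _⊢_
data _⊢_ (Γ : Formula → Set) : Formula → Set where
  hyp : ∀ {φ} → Γ φ → Γ ⊢ φ
  A1  : ∀ φ ψ → Γ ⊢ φ ⇒ (ψ ⇒ φ)
  A2  : ∀ φ ψ → Γ ⊢ ((φ ⇒ ψ) ⇒ ψ) ⇒ ((ψ ⇒ φ) ⇒ φ)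
  A3  : ∀ φ → Γ ⊢ 𝟘 ⇒ φ
  MP  : ∀ {φ ψ} → Γ ⊢ φ → Γ ⊢ φ ⇒ ψ → Γ ⊢ ψ
  Sf  : ∀ {φ ψ} χ → Γ ⊢ φ ⇒ ψ → Γ ⊢ (ψ ⇒ χ) ⇒ (φ ⇒ χ)
  WPf : ∀ {φ ψ} χ → Γ ⊢ φ ⇒ ψ → Γ ⊢ ψ ⇒ φ → Γ ⊢ (χ ⇒ φ) ⇒ (χ ⇒ ψ)
  R1  : ∀ {φ ψ} → Γ ⊢ φ ⇒ ψ → Γ ⊢ (∼ φ ⇒ ∼ ψ) ⇒ (ψ ⇒ φ)
  R2  : ∀ {φ ψ χ} → Γ ⊢ φ ⇒ ∼ ψ → Γ ⊢ (∼ φ ⇒ ψ) ⇒ ∼ χ →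
        Γ ⊢ (∼ (∼ φ ⇒ ψ) ⇒ χ) ⇒ (∼ φ ⇒ (∼ ψ ⇒ χ))

record Alg (c ℓ : Level) : Set (lsuc (c ⊔ ℓ)) where
  infixr 6 _↦_
  infix 4 _≈_
  field
    Carrier       : Set c
    _≈_           : Carrier → Carrier → Set ℓ
    _↦_           : Carrier → Carrier → Carrier
    O             : Carrier
    isEquivalence : IsEquivalence _≈_
    ↦-cong        : ∀ {x x' y y'} → x ≈ x' → y ≈ y' → (x ↦ y) ≈ (x' ↦ y')

  _′ : Carrier → Carrier
  x ′ = x ↦ O
  infix 8 _′

  𝟙 : Carrier
  𝟙 = O ′

  ⟦_⟧ : Formula → (ℕ → Carrier) → Carrier
  ⟦ var n ⟧ v = v n
  ⟦ φ ⇒ ψ ⟧ v = ⟦ φ ⟧ v ↦ ⟦ ψ ⟧ v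
  ⟦ 𝟘 ⟧ v = O

-- Equivalent algebraic semantics (generic definition).
-- δ, ε : unary terms, given as operations on formulas (δ(φ), ε(φ));
-- Δ : the set of equivalence formulas Δ(φ,ψ), a finite list.

module _ {c ℓ k : Level} where

  Consequence : (K : Alg c ℓ → Set k) (δ ε : Formula → Formula) →
                (Formula → Set) → Formula → Set (lsuc (c ⊔ ℓ) ⊔ k)
  Consequence K δ ε Γ φ =
    (A : Alg c ℓ) → K A → (v : ℕ → Alg.Carrier A) →
    (∀ ψ → Γ ψ → Alg._≈_ A (Alg.⟦_⟧ A (δ ψ) v) (Alg.⟦_⟧ A (ε ψ) v)) →
    Alg._≈_ A (Alg.⟦_⟧ A (δ φ) v) (Alg.⟦_⟧ A (ε φ) v)

  IsEquivalentAlgebraicSemantics :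
    (_⊩_ : (Formula → Set) → Formula → Set) →
    (K : Alg c ℓ → Set k) →
    (Δ : Formula → Formula → List Formula) →
    (δ ε : Formula → Formula) → Set (lsuc (c ⊔ ℓ) ⊔ k)
  IsEquivalentAlgebraicSemantics _⊩_ K Δ δ ε =
    (∀ (Γ : Formula → Set) (φ : Formula) →
       (Γ ⊩ φ → Consequence K δ ε Γ φ) × (Consequence K δ ε Γ φ → Γ ⊩ φ))
    ×
    (∀ (A : Alg c ℓ) → K A → (v : ℕ → Alg.Carrier A) → (φ ψ : Formula) →
       (Alg._≈_ A (Alg.⟦_⟧ A φ v) (Alg.⟦_⟧ A ψ v) →
          ∀ χ → χ ∈ Δ φ ψ → Alg._≈_ A (Alg.⟦_⟧ A (δ χ) v) (Alg.⟦_⟧ A (ε χ) v))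
       ×
       ((∀ χ → χ ∈ Δ φ ψ → Alg._≈_ A (Alg.⟦_⟧ A (δ χ) v) (Alg.⟦_⟧ A (ε χ) v)) →
          Alg._≈_ A (Alg.⟦_⟧ A φ v) (Alg.⟦_⟧ A ψ v)))

ΔLEA : Formula → Formula → List Formula
ΔLEA p q = (p ⇒ q) ∷ (q ⇒ p) ∷ []

δLEA : Formula → Formula
δLEA p = p

εLEA : Formula → Formula
εLEA p = p ⇒ p

record IsLEAQ {c ℓ} (A : Alg c ℓ) : Set (c ⊔ ℓ) where
  open Alg A
  field
    q1 : ∀ x y → (x ↦ (y ↦ x)) ≈ 𝟙
    q2 : ∀ x y → (((x ↦ y) ↦ y) ↦ ((y ↦ x) ↦ x)) ≈ 𝟙
    q3 : ∀ x → (O ↦ x) ≈ 𝟙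
    q4 : ∀ x → (x ↦ x) ≈ 𝟙
    q5 : ∀ x y → x ≈ 𝟙 → (x ↦ y) ≈ 𝟙 → y ≈ 𝟙
    q6 : ∀ x y z → (x ↦ y) ≈ 𝟙 → ((y ↦ z) ↦ (x ↦ z)) ≈ 𝟙
    q7 : ∀ x y → (x ↦ y) ≈ 𝟙 → ((x ′ ↦ y ′) ↦ (y ↦ x)) ≈ 𝟙
    q8 : ∀ x y → (x ↦ y) ≈ 𝟙 → (y ↦ x) ≈ 𝟙 → x ≈ y
    q9 : ∀ x y z → (x ↦ y ′) ≈ 𝟙 → ((x ′ ↦ y) ↦ z ′) ≈ 𝟙 →
         (((x ′ ↦ y) ′ ↦ z) ↦ (x ′ ↦ (y ′ ↦ z))) ≈ 𝟙

record IsLEIA {c ℓ} (A : Alg c ℓ) : Set (c ⊔ ℓ) where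
  open Alg A
  field
    i-a   : ∀ x → (O ↦ x) ≈ 𝟙
    i-b   : ∀ x → (x ↦ x) ≈ 𝟙
    i-c   : ∀ x → (x ↦ 𝟙) ≈ 𝟙
    ii    : ∀ x y → (x ↦ y) ≈ 𝟙 → (y ↦ x) ≈ 𝟙 → x ≈ y
    iii   : ∀ x y z → (x ↦ y) ≈ 𝟙 → (y ↦ z) ≈ 𝟙 → (x ↦ z) ≈ 𝟙
    iv    : ∀ x y → (x ↦ y) ≈ 𝟙 → (y ′ ↦ x ′) ≈ 𝟙
    v     : ∀ x → (x ′) ′ ≈ x
    vi    : ∀ x y → (x ↦ ((x ↦ y) ↦ y)) ≈ 𝟙
    vii   : ∀ x y → (y ↦ ((x ↦ y) ↦ y)) ≈ 𝟙
    viii  : ∀ x y z → (x ↦ z) ≈ 𝟙 → (y ↦ z) ≈ 𝟙 → (((x ↦ y) ↦ y) ↦ z) ≈ 𝟙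
    ix    : ∀ x y → (x ↦ y) ≈ 𝟙 → (y ↦ x) ≈ (x ′ ↦ y ′)
    x-⇒   : ∀ x y z → (x ↦ y ′) ≈ 𝟙 → ((x ′ ↦ y) ↦ z ′) ≈ 𝟙 →
            ((y ↦ z ′) ≈ 𝟙) × ((x ↦ (y ′ ↦ z) ′) ≈ 𝟙)
    x-⇐   : ∀ x y z → (y ↦ z ′) ≈ 𝟙 → (x ↦ (y ′ ↦ z) ′) ≈ 𝟙 →
            ((x ↦ y ′) ≈ 𝟙) × (((x ′ ↦ y) ↦ z ′) ≈ 𝟙)
    x-eq  : ∀ x y z → (x ↦ y ′) ≈ 𝟙 → ((x ′ ↦ y) ↦ z ′) ≈ 𝟙 →
            ((x ′ ↦ y) ′ ↦ z) ≈ (x ′ ↦ (y ′ ↦ z))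
    xi    : ∀ x y → (y ′ ↦ ((x ↦ y) ↦ y) ′) ≈ (x ↦ y)
    xii   : ∀ x y → (x ↦ (y ↦ x)) ≈ 𝟙

-- Soundness of L_LEA is checked rule by rule: every axiom evaluates to 1 by
-- (1)–(4), and each rule is mirrored by one of the quasi-identities (5)–(9).
-- Completeness comes from the Lindenbaum–Tarski algebra of Γ, whose elements
-- are formulas identified up to Γ-provable mutual implication; it satisfies
-- (1)–(9) because each of them is a derived rule of L_LEA.  The condition on Δ
-- is just (4) and (8).
--
-- In both axiomatisations x ≤ y :⇔ x → y = 1 is a bounded partial order with
-- antitone involution ′, in which (x → y) → y is the join of x and y, and
-- x → y ≈ y′ → x′ when y ≤ x.  From (1)–(9) one then derives (x) and (xi) by a
-- short computation with relative complements; conversely (6) follows from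
-- (xi), which writes x → z as z′ → ((x → z) → z)′, a term monotone in the join
-- (x → z) → z.
module Submission where

open import Defs
open import Level using (Level; Lift; lift; lower; _⊔_)
open import Data.Nat using (ℕ)
open import Data.Product using (_×_; _,_; proj₁; proj₂)
open import Data.List.Membership.Propositional using (_∈_)
open import Data.List.Relation.Unary.Any using (here; there)
open import Relation.Binary using (IsEquivalence; Setoid)
open import Relation.Binary.PropositionalEquality using (_≡_; refl; cong₂; subst; sym)

module Order {c ℓ : Level} (A : Alg c ℓ) where
  open Alg A
  open IsEquivalence isEquivalence renaming (refl to ≈-refl; sym to ≈-sym; trans to ≈-trans)

  infix 4 _≤_
  _≤_ : Carrier → Carrier → Set ℓ
  x ≤ y = (x ↦ y) ≈ 𝟙

  setoid : Setoid c ℓ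
  setoid = record { isEquivalence = isEquivalence }

  ≤-respʳ-≈ : ∀ {x y z} → y ≈ z → x ≤ y → x ≤ z
  ≤-respʳ-≈ y≈z x≤y = ≈-trans (↦-cong ≈-refl (≈-sym y≈z)) x≤y

  ≤-respˡ-≈ : ∀ {x y z} → x ≈ y → x ≤ z → y ≤ z
  ≤-respˡ-≈ x≈y x≤z = ≈-trans (↦-cong (≈-sym x≈y) ≈-refl) x≤z

  record IsLEIACore : Set (c ⊔ ℓ) where
    field
      ≤-refl           : ∀ x → x ≤ x
      ≤-𝟙              : ∀ x → x ≤ 𝟙
      ≤-antisym        : ∀ x y → x ≤ y → y ≤ x → x ≈ y
      ′-antitone       : ∀ x y → x ≤ y → y ′ ≤ x ′
      ′-involutive     : ∀ x → x ′ ′ ≈ x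
      join-upper       : ∀ x y → x ≤ ((x ↦ y) ↦ y)
      join-least       : ∀ x y z → x ≤ z → y ≤ z → ((x ↦ y) ↦ y) ≤ z
      ↦-contrapositive : ∀ x y → x ≤ y → (y ↦ x) ≈ (x ′ ↦ y ′)

    ≤′-swap : ∀ x y → x ≤ y ′ → y ≤ x ′
    ≤′-swap x y h = ≤-respˡ-≈ (′-involutive y) (′-antitone x (y ′) h)

    ′↦-comm : ∀ x y → x ≤ y ′ → (x ′ ↦ y) ≈ (y ′ ↦ x)
    ′↦-comm x y h = ≈-sym (≈-trans (↦-contrapositive x (y ′) h) (↦-cong ≈-refl (′-involutive y)))

    join-of-≤ : ∀ x y → x ≤ y → ((y ↦ x) ↦ x) ≈ y
    join-of-≤ x y h = ≤-antisym _ _ (join-least y x y (≤-refl y) h) (join-upper y x)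

    𝟙≤⇒≈𝟙 : ∀ x → 𝟙 ≤ x → x ≈ 𝟙
    𝟙≤⇒≈𝟙 x = ≤-antisym x 𝟙 (≤-𝟙 x)

    ≈⇒≤ : ∀ {x y} → x ≈ y → x ≤ y
    ≈⇒≤ {x} x≈y = ≤-respʳ-≈ x≈y (≤-refl x)

  module FromQuasiIdentities (Q : IsLEAQ A) where
    open IsLEAQ Q

    ≤-trans : ∀ x y z → x ≤ y → y ≤ z → x ≤ z
    ≤-trans x y z x≤y y≤z = q5 _ _ y≤z (q6 x y z x≤y)

    ≤-𝟙 : ∀ x → x ≤ 𝟙
    ≤-𝟙 x = q5 𝟙 (x ↦ 𝟙) ≈-refl (q1 𝟙 x)

    ′-antitone : ∀ x y → x ≤ y → y ′ ≤ x ′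
    ′-antitone x y = q6 x y O

    𝟙↦-identity : ∀ x → (𝟙 ↦ x) ≈ x
    𝟙↦-identity x = q8 _ _ (q5 _ _ (≈-trans (↦-cong (≤-𝟙 x) ≈-refl) (q4 𝟙)) (q2 x 𝟙)) (q1 x 𝟙)

    ′′-≤ : ∀ x → x ′ ′ ≤ x
    ′′-≤ x = ≤-respʳ-≈ (≈-trans (↦-cong (q3 x) ≈-refl) (𝟙↦-identity x)) (q2 x O)

    ′-involutive : ∀ x → x ′ ′ ≈ x
    ′-involutive x = q8 _ _ (′′-≤ x) (q5 _ _ (′′-≤ (x ′)) (q7 (x ′ ′) x (′′-≤ x)))

    join-upper : ∀ x y → x ≤ ((x ↦ y) ↦ y)
    join-upper x y = ≤-trans _ _ _ (q1 x (y ↦ x)) (q2 y x)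

    join-least : ∀ x y z → x ≤ z → y ≤ z → ((x ↦ y) ↦ y) ≤ z
    join-least x y z x≤z y≤z =
      ≤-respʳ-≈ (≈-trans (↦-cong x≤z ≈-refl) (𝟙↦-identity z))
        (≤-trans _ _ _ (q2 x y) (≤-trans _ _ _ (q6 (z ↦ x) (y ↦ x) x (q6 y z x y≤z)) (q2 z x)))

    ↦-contrapositive : ∀ x y → x ≤ y → (y ↦ x) ≈ (x ′ ↦ y ′)
    ↦-contrapositive x y h =
      q8 _ _ (≤-respˡ-≈ (↦-cong (′-involutive y) (′-involutive x)) (q7 (y ′) (x ′) (′-antitone x y h)))
             (q7 x y h)

    core : IsLEIACore
    core = record
      { ≤-refl = q4 ; ≤-𝟙 = ≤-𝟙 ; ≤-antisym = q8 ; ′-antitone = ′-antitone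
      ; ′-involutive = ′-involutive ; join-upper = join-upper ; join-least = join-least
      ; ↦-contrapositive = ↦-contrapositive }
    open IsLEIACore core using (≤′-swap; ′↦-comm; join-of-≤)

    ↦-monoʳ-below : ∀ x y z → x ≤ y → y ≤ z → (z ↦ x) ≤ (z ↦ y)
    ↦-monoʳ-below x y z x≤y y≤z =
      ≤-respˡ-≈ (≈-sym (↦-contrapositive x z (≤-trans _ _ _ x≤y y≤z)))
        (≤-respʳ-≈ (≈-sym (↦-contrapositive y z y≤z)) (q6 (y ′) (x ′) (z ′) (′-antitone x y x≤y)))

    ↦-↦′-cancel : ∀ x y → x ≤ y → (y ↦ (y ↦ x) ′) ≈ x ′
    ↦-↦′-cancel x y x≤y = begin
      y ↦ u ′                 ≈⟨ ↦-contrapositive (u ′) y u′≤y ⟩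
      u ′ ′ ↦ y ′             ≈⟨ ↦-cong (′-involutive u) ≈-refl ⟩
      u ↦ y ′                 ≈⟨ ↦-cong (↦-contrapositive x y x≤y) ≈-refl ⟩
      (x ′ ↦ y ′) ↦ y ′       ≈⟨ join-of-≤ (y ′) (x ′) (′-antitone x y x≤y) ⟩
      x ′                     ∎
      where
        open import Relation.Binary.Reasoning.Setoid setoid
        u = y ↦ x
        u′≤y : u ′ ≤ y
        u′≤y = ≤-respʳ-≈ (′-involutive y) (′-antitone _ _ (↦-monoʳ-below O x y (q3 x) x≤y))

    axiom-x⇒ : ∀ x y z → x ≤ y ′ → (x ′ ↦ y) ≤ z ′ → (y ≤ z ′) × (x ≤ (y ′ ↦ z) ′)
    axiom-x⇒ x y z x≤y′ s≤z′ = ≤-trans _ _ _ y≤s s≤z′ , ≤′-swap (y ′ ↦ z) x y′↦z≤x′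
      where
        s = x ′ ↦ y
        y≤s : y ≤ s
        y≤s = q1 y (x ′)
        y′↦s′≈x′ : (y ′ ↦ s ′) ≈ x ′
        y′↦s′≈x′ = ≈-trans (↦-cong ≈-refl (↦-cong (′↦-comm x y x≤y′) ≈-refl)) (↦-↦′-cancel x (y ′) x≤y′)
        y′↦z≤x′ : (y ′ ↦ z) ≤ x ′
        y′↦z≤x′ = ≤-respʳ-≈ y′↦s′≈x′
          (↦-monoʳ-below z (s ′) (y ′) (≤′-swap s z s≤z′) (′-antitone y s y≤s))

    axiom-x⇐ : ∀ x y z → y ≤ z ′ → x ≤ (y ′ ↦ z) ′ → (x ≤ y ′) × ((x ′ ↦ y) ≤ z ′)
    axiom-x⇐ x y z y≤z′ x≤t′ =
      x≤y′ , ≤-respˡ-≈ (≈-sym (′↦-comm x y x≤y′)) (≤′-swap z (y ′ ↦ x) (proj₂ dual))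
      where
        z≤y′ = ≤′-swap y z y≤z′
        dual = axiom-x⇒ z y x z≤y′ (≤-respˡ-≈ (≈-sym (′↦-comm z y z≤y′)) (≤′-swap x (y ′ ↦ z) x≤t′))
        x≤y′ = ≤′-swap y x (proj₁ dual)

    axiom-x-eq : ∀ x y z → x ≤ y ′ → (x ′ ↦ y) ≤ z ′ →
                 ((x ′ ↦ y) ′ ↦ z) ≈ (x ′ ↦ (y ′ ↦ z))
    axiom-x-eq x y z x≤y′ s≤z′ = q8 _ _ (q9 x y z x≤y′ s≤z′) converse
      where
        y≤z′ = proj₁ (axiom-x⇒ x y z x≤y′ s≤z′)
        x≤t′ = proj₂ (axiom-x⇒ x y z x≤y′ s≤z′)
        z≤y′ = ≤′-swap y z y≤z′
        t≈z′↦y : (y ′ ↦ z) ≈ (z ′ ↦ y)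
        t≈z′↦y = ≈-sym (′↦-comm z y z≤y′)
        lhs≈ : (x ′ ↦ (y ′ ↦ z)) ≈ ((z ′ ↦ y) ′ ↦ x)
        lhs≈ = ≈-trans (′↦-comm x (y ′ ↦ z) x≤t′) (↦-cong (↦-cong t≈z′↦y ≈-refl) ≈-refl)
        rhs≈ : (z ′ ↦ (y ′ ↦ x)) ≈ ((x ′ ↦ y) ′ ↦ z)
        rhs≈ = ≈-trans (↦-cong ≈-refl (≈-sym (′↦-comm x y x≤y′))) (′↦-comm z (x ′ ↦ y) (≤′-swap _ z s≤z′))
        converse = ≤-respˡ-≈ (≈-sym lhs≈)
          (≤-respʳ-≈ rhs≈ (q9 z y x z≤y′ (≤-respˡ-≈ t≈z′↦y (≤′-swap x (y ′ ↦ z) x≤t′))))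

    axiom-xi : ∀ x y → (y ′ ↦ ((x ↦ y) ↦ y) ′) ≈ (x ↦ y)
    axiom-xi x y = ≈-trans (≈-sym (↦-contrapositive y j (q1 y (x ↦ y))))
                           (q8 _ _ (q6 x j y (join-upper x y)) (join-upper (x ↦ y) y))
      where j = (x ↦ y) ↦ y

    isLEIA : IsLEIA A
    isLEIA = record
      { i-a = q3 ; i-b = q4 ; i-c = ≤-𝟙 ; ii = q8 ; iii = ≤-trans ; iv = ′-antitone
      ; v = ′-involutive ; vi = join-upper ; vii = λ x y → q1 y (x ↦ y) ; viii = join-least
      ; ix = ↦-contrapositive ; x-⇒ = axiom-x⇒ ; x-⇐ = axiom-x⇐ ; x-eq = axiom-x-eq
      ; xi = axiom-xi ; xii = q1 }

  module FromLEIA (L : IsLEIA A) where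
    open IsLEIA L

    core : IsLEIACore
    core = record
      { ≤-refl = i-b ; ≤-𝟙 = i-c ; ≤-antisym = ii ; ′-antitone = iv ; ′-involutive = v
      ; join-upper = vi ; join-least = viii ; ↦-contrapositive = ix }
    open IsLEIACore core using (≤′-swap; ′↦-comm; join-of-≤; 𝟙≤⇒≈𝟙; ≈⇒≤)

    -- y ≈ x′ ↦ d for d := (x′ ↦ y′)′, so reassociating by (x) reduces the goal to p ≤ p′ ↦ d.
    ′↦-monoʳ-below : ∀ x y z → x ≤ y → y ≤ z ′ → (z ′ ↦ x) ≤ (z ′ ↦ y)
    ′↦-monoʳ-below x y z x≤y y≤z′ = ≤-respʳ-≈ (≈-trans reassoc (↦-cong ≈-refl x′↦d≈y)) p≤p′↦d
      where
        d = (x ′ ↦ y ′) ′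
        x′↦y′≈y↦x : (x ′ ↦ y ′) ≈ (y ↦ x)
        x′↦y′≈y↦x = ≈-sym (ix x y x≤y)
        x≤d′ : x ≤ d ′
        x≤d′ = ≤-respʳ-≈ (≈-sym (≈-trans (v (x ′ ↦ y ′)) x′↦y′≈y↦x)) (xii x y)
        x′↦d≈y : (x ′ ↦ d) ≈ y
        x′↦d≈y = ≈-trans (′↦-comm x d x≤d′)
                   (≈-trans (↦-cong (≈-trans (v _) x′↦y′≈y↦x) ≈-refl) (join-of-≤ x y x≤y))
        hyps = x-⇐ z x d x≤d′ (≤-respʳ-≈ (↦-cong (≈-sym x′↦d≈y) ≈-refl) (≤′-swap y z y≤z′))
        reassoc : ((z ′ ↦ x) ′ ↦ d) ≈ (z ′ ↦ (x ′ ↦ d))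
        reassoc = x-eq z x d (proj₁ hyps) (proj₂ hyps)
        p = z ′ ↦ x
        p≤p′↦d : p ≤ (p ′ ↦ d)
        p≤p′↦d = ≤-respʳ-≈ (≈-sym (′↦-comm p d (proj₂ hyps))) (xii p (d ′))

    suffixing : ∀ x y z → x ≤ y → (y ↦ z) ≤ (x ↦ z)
    suffixing x y z x≤y = ≤-respˡ-≈ (xi y z) (≤-respʳ-≈ (xi x z) mono)
      where
        jx = (x ↦ z) ↦ z
        jy = (y ↦ z) ↦ z
        jx≤jy : jx ≤ jy
        jx≤jy = viii x z jy (iii x y jy x≤y (vi y z)) (vii y z)
        mono : (z ′ ↦ jy ′) ≤ (z ′ ↦ jx ′)
        mono = ′↦-monoʳ-below (jy ′) (jx ′) z (iv jx jy jx≤jy) (iv z jx (vii x z))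

    isLEAQ : IsLEAQ A
    isLEAQ = record
      { q1 = xii
      ; q2 = λ x y → viii x y _ (vii y x) (vi y x)
      ; q3 = i-a
      ; q4 = i-b
      ; q5 = λ x y x≈𝟙 x≤y → 𝟙≤⇒≈𝟙 y (≤-respˡ-≈ x≈𝟙 x≤y)
      ; q6 = suffixing
      ; q7 = λ x y x≤y → ≈⇒≤ (≈-sym (ix x y x≤y))
      ; q8 = ii
      ; q9 = λ x y z h₁ h₂ → ≈⇒≤ (x-eq x y z h₁ h₂) }

module Semantics {c ℓ : Level} (A : Alg c ℓ) (Q : IsLEAQ A) where
  open Alg A
  open IsLEAQ Q
  open IsEquivalence isEquivalence renaming (refl to ≈-refl; sym to ≈-sym; trans to ≈-trans)

  ≈𝟙⇒≈↦self : ∀ {x} → x ≈ 𝟙 → x ≈ (x ↦ x)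
  ≈𝟙⇒≈↦self x≈𝟙 = ≈-trans x≈𝟙 (≈-sym (q4 _))

  ≈↦self⇒≈𝟙 : ∀ {x} → x ≈ (x ↦ x) → x ≈ 𝟙
  ≈↦self⇒≈𝟙 h = ≈-trans h (q4 _)

  module _ (Γ : Formula → Set) (v : ℕ → Carrier)
           (Γ-valid : ∀ ψ → Γ ψ → ⟦ ψ ⟧ v ≈ (⟦ ψ ⟧ v ↦ ⟦ ψ ⟧ v)) where

    ⊢⇒≈𝟙 : ∀ {φ} → Γ ⊢ φ → ⟦ φ ⟧ v ≈ 𝟙
    ⊢⇒≈𝟙 (hyp {φ} γ)  = ≈↦self⇒≈𝟙 (Γ-valid φ γ)
    ⊢⇒≈𝟙 (A1 φ ψ)     = q1 _ _
    ⊢⇒≈𝟙 (A2 φ ψ)     = q2 _ _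
    ⊢⇒≈𝟙 (A3 φ)       = q3 _
    ⊢⇒≈𝟙 (MP p q)     = q5 _ _ (⊢⇒≈𝟙 p) (⊢⇒≈𝟙 q)
    ⊢⇒≈𝟙 (Sf χ p)     = q6 _ _ _ (⊢⇒≈𝟙 p)
    ⊢⇒≈𝟙 (WPf χ p q)  = ≈-trans (↦-cong ≈-refl (↦-cong ≈-refl (≈-sym (q8 _ _ (⊢⇒≈𝟙 p) (⊢⇒≈𝟙 q))))) (q4 _)
    ⊢⇒≈𝟙 (R1 p)       = q7 _ _ (⊢⇒≈𝟙 p)
    ⊢⇒≈𝟙 (R2 p q)     = q9 _ _ _ (⊢⇒≈𝟙 p) (⊢⇒≈𝟙 q)

  module _ (v : ℕ → Carrier) (φ ψ : Formula) where

    ≈⇒Δ-valid : ⟦ φ ⟧ v ≈ ⟦ ψ ⟧ v → ∀ χ → χ ∈ ΔLEA φ ψ → ⟦ χ ⟧ v ≈ (⟦ χ ⟧ v ↦ ⟦ χ ⟧ v)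
    ≈⇒Δ-valid φ≈ψ _ (here refl)         = ≈𝟙⇒≈↦self (≈-trans (↦-cong ≈-refl (≈-sym φ≈ψ)) (q4 _))
    ≈⇒Δ-valid φ≈ψ _ (there (here refl)) = ≈𝟙⇒≈↦self (≈-trans (↦-cong ≈-refl φ≈ψ) (q4 _))
    ≈⇒Δ-valid φ≈ψ _ (there (there ()))

    Δ-valid⇒≈ : (∀ χ → χ ∈ ΔLEA φ ψ → ⟦ χ ⟧ v ≈ (⟦ χ ⟧ v ↦ ⟦ χ ⟧ v)) → ⟦ φ ⟧ v ≈ ⟦ ψ ⟧ v
    Δ-valid⇒≈ h = q8 _ _ (≈↦self⇒≈𝟙 (h _ (here refl))) (≈↦self⇒≈𝟙 (h _ (there (here refl))))

soundness : ∀ {c ℓ} Γ φ → Γ ⊢ φ → Consequence (IsLEAQ {c} {ℓ}) δLEA εLEA Γ φ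
soundness Γ φ Γ⊢φ A Q v Γ-valid =
  Semantics.≈𝟙⇒≈↦self A Q (Semantics.⊢⇒≈𝟙 A Q Γ v Γ-valid Γ⊢φ)

⇒-refl : ∀ {Γ} φ → Γ ⊢ φ ⇒ φ
⇒-refl φ = MP (MP (MP (A3 𝟘) (A1 (𝟘 ⇒ 𝟘) (φ ⇒ (𝟘 ⇒ 𝟘)))) (A2 φ (𝟘 ⇒ 𝟘))) (Sf φ (A1 φ (𝟘 ⇒ 𝟘)))

⇒-trans : ∀ {Γ φ ψ χ} → Γ ⊢ φ ⇒ ψ → Γ ⊢ ψ ⇒ χ → Γ ⊢ φ ⇒ χ
⇒-trans {χ = χ} φ⇒ψ ψ⇒χ = MP ψ⇒χ (Sf χ φ⇒ψ)

module Lindenbaum {c ℓ : Level} (Γ : Formula → Set) where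

  infix 4 _⇔_
  _⇔_ : Formula → Formula → Set
  φ ⇔ ψ = (Γ ⊢ φ ⇒ ψ) × (Γ ⊢ ψ ⇒ φ)

  -- Lifted to the levels c and ℓ, as the theorem quantifies over Alg c ℓ.
  algebra : Alg c ℓ
  algebra = record
    { Carrier = Lift c Formula
    ; _≈_ = λ a b → Lift ℓ (lower a ⇔ lower b)
    ; _↦_ = λ a b → lift (lower a ⇒ lower b)
    ; O = lift 𝟘
    ; isEquivalence = record
        { refl = lift (⇒-refl _ , ⇒-refl _)
        ; sym = λ { (lift (p , q)) → lift (q , p) }
        ; trans = λ { (lift (p , q)) (lift (r , s)) → lift (⇒-trans p r , ⇒-trans s q) } }
    ; ↦-cong = λ { {x} {x′} {y} {y′} (lift (p , q)) (lift (r , s)) →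
        lift (⇒-trans (Sf (lower y) q) (WPf (lower x′) r s) , ⇒-trans (Sf (lower y′) p) (WPf (lower x) s r)) }
    }

  ⊢⇒⇔𝟙 : ∀ {φ} → Γ ⊢ φ → φ ⇔ 𝟘 ⇒ 𝟘
  ⊢⇒⇔𝟙 {φ} p = MP (A3 𝟘) (A1 (𝟘 ⇒ 𝟘) φ) , MP p (A1 φ (𝟘 ⇒ 𝟘))

  ⇔𝟙⇒⊢ : ∀ {φ} → φ ⇔ 𝟘 ⇒ 𝟘 → Γ ⊢ φ
  ⇔𝟙⇒⊢ (_ , q) = MP (A3 𝟘) q

  isLEAQ : IsLEAQ algebra
  isLEAQ = record
    { q1 = λ _ _ → lift (⊢⇒⇔𝟙 (A1 _ _))
    ; q2 = λ _ _ → lift (⊢⇒⇔𝟙 (A2 _ _))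
    ; q3 = λ _ → lift (⊢⇒⇔𝟙 (A3 _))
    ; q4 = λ _ → lift (⊢⇒⇔𝟙 (⇒-refl _))
    ; q5 = λ _ _ p q → lift (⊢⇒⇔𝟙 (MP (⇔𝟙⇒⊢ (lower p)) (⇔𝟙⇒⊢ (lower q))))
    ; q6 = λ _ _ _ h → lift (⊢⇒⇔𝟙 (Sf _ (⇔𝟙⇒⊢ (lower h))))
    ; q7 = λ _ _ h → lift (⊢⇒⇔𝟙 (R1 (⇔𝟙⇒⊢ (lower h))))
    ; q8 = λ _ _ h₁ h₂ → lift (⇔𝟙⇒⊢ (lower h₁) , ⇔𝟙⇒⊢ (lower h₂))
    ; q9 = λ _ _ _ h₁ h₂ → lift (⊢⇒⇔𝟙 (R2 (⇔𝟙⇒⊢ (lower h₁)) (⇔𝟙⇒⊢ (lower h₂))))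
    }

  generic : ℕ → Lift c Formula
  generic n = lift (var n)

  ⟦⟧-generic : ∀ φ → Alg.⟦_⟧ algebra φ generic ≡ lift φ
  ⟦⟧-generic (var n) = refl
  ⟦⟧-generic (φ ⇒ ψ) = cong₂ (λ a b → lift (lower a ⇒ lower b)) (⟦⟧-generic φ) (⟦⟧-generic ψ)
  ⟦⟧-generic 𝟘       = refl

  completeness : ∀ φ → Consequence (IsLEAQ {c} {ℓ}) δLEA εLEA Γ φ → Γ ⊢ φ
  completeness φ valid = provable (proj₂ (lower (valid algebra isLEAQ generic Γ-valid)))
    where
      provable : Γ ⊢ (lower (Alg.⟦_⟧ algebra φ generic) ⇒ lower (Alg.⟦_⟧ algebra φ generic))
                   ⇒ lower (Alg.⟦_⟧ algebra φ generic) → Γ ⊢ φ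
      provable p = subst (λ a → Γ ⊢ lower a) (⟦⟧-generic φ) (MP (⇒-refl _) p)
      Γ-valid : ∀ ψ → Γ ψ → Alg._≈_ algebra (Alg.⟦_⟧ algebra ψ generic)
                  (Alg._↦_ algebra (Alg.⟦_⟧ algebra ψ generic) (Alg.⟦_⟧ algebra ψ generic))
      Γ-valid ψ γ = subst (λ a → Lift ℓ (lower a ⇔ (lower a ⇒ lower a))) (sym (⟦⟧-generic ψ))
                      (lift (A1 ψ ψ , MP (hyp γ) (A1 ψ (ψ ⇒ ψ))))

theorem4p3 : ∀ {c ℓ : Level} →
    IsEquivalentAlgebraicSemantics _⊢_ (IsLEAQ {c} {ℓ}) ΔLEA δLEA εLEA
    × (∀ (A : Alg c ℓ) → (IsLEAQ A → IsLEIA A) × (IsLEIA A → IsLEAQ A))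
theorem4p3 =
  ( (λ Γ φ → soundness Γ φ , Lindenbaum.completeness Γ φ)
  , λ A Q v φ ψ → Semantics.≈⇒Δ-valid A Q v φ ψ , Semantics.Δ-valid⇒≈ A Q v φ ψ )
  , λ A → Order.FromQuasiIdentities.isLEIA A , Order.FromLEIA.isLEAQ A
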